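{- Let $T$ be a tree of order $n\ge 6$ with bipartition classes $X,Y$ satisfying $|X|\ge 3$ and $|Y|\ge 3$, and let $Z=\{X,Y,\emptyset\}$. For $x\in V(T)$ let $Z_x=\{X\setminus\{x\},Y,\{x\}\}$ if $x\in X$ and $Z_x=\{X,Y\setminus\{x\},\{x\}\}$ if $x\in Y$. Then for distinct vertices $u,v\in V(T)$, the vertices $Z_u$ and $Z_v$ of $\mathcal{B}_3(T)$ have a common neighbor in $\mathcal{B}_3(T)$ distinct from $Z$ if and only if $u$ and $v$ are nonadjacent in $T$.
   Context: A stable $k$-partition of a graph $G$ is a multiset of $k$ independent sets (some possibly empty) partitioning $V(G)$; $P-v$ is obtained by deleting $v$ from its part. $\mathcal{B}_k(G)$ has vertex set the stable $k$-partitions of $G$, with distinct $P,Q$ adjacent iff $P-v=Q-v$ for some $v\in V(G)$. -}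

module Defs where

open import Data.Nat using (ℕ; suc; _≤_)
open import Data.Bool using (Bool; true; false; if_then_else_)
open import Data.Fin using (Fin)
open import Data.Fin.Subset using (Subset; _∈_; _-_; ∁; ⁅_⁆; ∣_∣)
open import Data.Vec using (Vec; []; _∷_; lookup; toList; map)
open import Data.List using (List; []; _∷_; length; head; last)
open import Data.List.Relation.Unary.Unique.Propositional using (Unique)
open import Data.List.Relation.Binary.Permutation.Propositional using (_↭_)
open import Data.Maybe using (Maybe; just; nothing)
open import Data.Product using (Σ; ∃; ∃-syntax; _×_; _,_)
open import Data.Unit using (⊤)
open import Data.Empty using (⊥)
open import Relation.Nullary using (¬_)
open import Relation.Binary.PropositionalEquality using (_≡_)

record Graph (n : ℕ) : Set₁ where
  field
    Adj    : Fin n → Fin n → Set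
    sym    : ∀ {u v} → Adj u v → Adj v u
    irrefl : ∀ {u} → ¬ Adj u u
open Graph public

Chain : ∀ {n} → Graph n → List (Fin n) → Set
Chain G []           = ⊤
Chain G (x ∷ [])     = ⊤
Chain G (x ∷ y ∷ xs) = Adj G x y × Chain G (y ∷ xs)

Walk : ∀ {n} → Graph n → Fin n → Fin n → List (Fin n) → Set
Walk G u v ws = head ws ≡ just u × last ws ≡ just v × Chain G ws

Connected : ∀ {n} → Graph n → Set
Connected G = ∀ u v → ∃[ ws ] Walk G u v ws

IsCycle : ∀ {n} → Graph n → List (Fin n) → Set
IsCycle G cs = 3 ≤ length cs × Unique cs × Chain G cs ×
               (∃[ a ] ∃[ b ] head cs ≡ just a × last cs ≡ just b × Adj G b a)

Acyclic : ∀ {n} → Graph n → Set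
Acyclic G = ∀ cs → ¬ IsCycle G cs

IsTree : ∀ {n} → Graph n → Set
IsTree G = Connected G × Acyclic G

Independent : ∀ {n} → Graph n → Subset n → Set
Independent G S = ∀ u v → u ∈ S → v ∈ S → ¬ Adj G u v

IsBipartition : ∀ {n} → Graph n → Subset n → Subset n → Set
IsBipartition G X Y = Y ≡ ∁ X × Independent G X × Independent G Y

-- A k-tuple of parts; as a vertex of B_k it is taken up to reordering (multiset).
Parts : ℕ → ℕ → Set
Parts n k = Vec (Subset n) k

IsStablePartition : ∀ {n k} → Graph n → Parts n k → Set
IsStablePartition G P =
  (∀ i → Independent G (lookup P i)) ×
  (∀ v → Σ (Fin _) λ i → v ∈ lookup P i × (∀ j → v ∈ lookup P j → j ≡ i))

_≈ₚ_ : ∀ {n k} → Parts n k → Parts n k → Set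
P ≈ₚ Q = toList P ↭ toList Q

delV : ∀ {n k} → Parts n k → Fin n → Parts n k
delV P v = map (λ S → S - v) P

AdjB : ∀ {n k} → Parts n k → Parts n k → Set
AdjB P Q = ¬ (P ≈ₚ Q) × ∃[ v ] (delV P v ≈ₚ delV Q v)

Zpart : ∀ {n} → Subset n → Subset n → Parts n 3
Zpart X Y = X ∷ Y ∷ Data.Fin.Subset.⊥ ∷ []

Zx : ∀ {n} → Subset n → Subset n → Fin n → Parts n 3
Zx X Y x = if lookup X x
             then (X - x) ∷ Y ∷ ⁅ x ⁆ ∷ []
             else X ∷ (Y - x) ∷ ⁅ x ⁆ ∷ []

-- A neighbour of a stable partition P in B₃ is P with a single vertex moved to another part, and
-- Z_x is Z with x moved into the empty part.  If u and v are not adjacent, moving v next to u in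
-- Z_u gives {X - u - v, Y - u - v, {u, v}}, which is also Z_v with u moved next to v, and differs
-- from Z_u, Z_v and Z.  Conversely let u ∈ X and v ∈ Y be adjacent and let W be obtained from Z_u
-- by moving a and from Z_v by moving b.  If a = u, then W is Z with u moved into some part, which
-- gives Z, Z_u, or puts u next to v; symmetrically if b = v.  Otherwise W agrees with Z_u away
-- from a, and with Z_v away from b, about which vertices share a part.  As u is alone in Z_u and
-- v alone in Z_v, a partner of u in X or of v in Y (there are enough since |X|, |Y| ≥ 3) gives a
-- pair that is together in one of them and apart in the other; when a = v and b = u, pigeonhole
-- on u, v, x ∈ X, y ∈ Y does it.
module Submission where

open import Defs
open import Data.Nat using (ℕ; _≤_)
open import Data.Fin using (Fin)
open import Data.Fin.Subset using (Subset; ∣_∣)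
open import Data.Product using (_×_; Σ-syntax)
open import Relation.Nullary using (¬_)
open import Relation.Binary.PropositionalEquality using (_≡_)
open import Function.Bundles using (_⇔_)

open import Data.Empty using (⊥; ⊥-elim)
open import Data.Fin using (zero; suc; _<_; #_)
open import Data.Fin.Properties using (_≟_; any?; pigeonhole; 0≢1+n; suc-injective)
open import Data.Fin.Subset
  using (inside; outside; _∈_; _∉_; _⊆_; _─_; _-_; _∪_; ∁; ⁅_⁆; Nonempty) renaming (⊥ to ∅)
open import Data.Fin.Subset.Properties
  using ( _∈?_; ∉⊥; x∈⁅x⁆; x∈⁅y⁆⇒x≡y; x∉⁅y⁆⇒x≢y; ∣⁅x⁆∣≡1; x∈p∪q⁺; x∈p∪q⁻; p─q⊆p; p─q─q≡p─q
        ; x∈p∧x≢y⇒x∈p-y; x∈∁p⇒x∉p; x∉p⇒x∈∁p; ⊆-antisym; p⊆q⇒∣p∣≤∣q∣; Empty-unique)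
open import Data.List as List using (List; []; _∷_; length; filter)
open import Data.List.Properties using (∷-injectiveˡ; ∷-injectiveʳ)
open import Data.List.Relation.Binary.Permutation.Propositional using (_↭_; ↭-sym; ↭-trans; ↭-reflexive)
open import Data.List.Relation.Binary.Permutation.Propositional.Properties
  using (Any-resp-↭; ↭-map-inv; ↭-length; filter-↭)
open import Data.Nat using (suc; _+_; s≤s; z≤n)
open import Data.Nat.Properties using (≤-trans; ≤-reflexive; +-monoʳ-≤; +-suc; n≤1+n; n<1+n; <-irrefl)
import Data.Nat.Properties as ℕ
open import Data.Product using (_,_; proj₁; proj₂; Σ; ∃-syntax; ∃₂)
open import Data.Sum using (_⊎_; inj₁; inj₂; [_,_])
open import Data.Vec using (Vec; []; _∷_; there; lookup; toList; map; updateAt)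
open import Data.Vec.Properties
  using (lookup-map; lookup∘updateAt; lookup∘updateAt′; toList-map; []=⇒lookup; lookup⇒[]=)
open import Data.Vec.Relation.Binary.Pointwise.Extensional using (ext; Pointwise-≡⇒≡)
open import Data.Vec.Relation.Unary.Any using (Any; index)
open import Data.Vec.Relation.Unary.Any.Properties using (toList⁺; toList⁻; lookup-index)
open import Data.Vec.Membership.Propositional using (lose)
open import Data.Vec.Membership.Propositional.Properties using (∈-lookup; ∈-toList⁺; ∈-toList⁻)
open import Function using (_∘_; flip)
open import Function.Bundles using (mk⇔)
open import Relation.Nullary using (yes; no; ¬?; _×-dec_; contradiction)
open import Relation.Binary.PropositionalEquality as ≡ using (_≢_; refl; cong; cong₂; subst; ≢-sym)

private
  variable
    n k : ℕ
    a b w w′ x y : Fin n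
    i j l : Fin k
    G : Graph n

x∈p─q⇒x∉q : (p q : Subset n) → x ∈ p ─ q → x ∉ q
x∈p─q⇒x∉q (_ ∷ p) (_ ∷ q) (there x∈p─q) (there x∈q) = x∈p─q⇒x∉q p q x∈p─q x∈q

x∈p-y⁻ : (p : Subset n) → x ∈ p - y → x ≢ y × x ∈ p
x∈p-y⁻ {y = y} p x∈p-y = x∉⁅y⁆⇒x≢y (x∈p─q⇒x∉q p ⁅ y ⁆ x∈p-y) , p─q⊆p p ⁅ y ⁆ x∈p-y

∈∧∉⇒≢ : {p : Subset n} → x ∈ p → y ∉ p → x ≢ y
∈∧∉⇒≢ x∈p y∉p refl = y∉p x∈p

p⊆⁅x⁆⇒p-x≡∅ : (p : Subset n) → p ⊆ ⁅ x ⁆ → p - x ≡ ∅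
p⊆⁅x⁆⇒p-x≡∅ p p⊆⁅x⁆ = Empty-unique λ (w , w∈p-x) →
  let w≢x , w∈p = x∈p-y⁻ p w∈p-x in w≢x (x∈⁅y⁆⇒x≡y _ (p⊆⁅x⁆ w∈p))

⁅x⁆-x≡∅-x : (x : Fin n) → ⁅ x ⁆ - x ≡ ∅ - x
⁅x⁆-x≡∅-x x = ≡.trans (p⊆⁅x⁆⇒p-x≡∅ ⁅ x ⁆ (λ w∈ → w∈)) (≡.sym (p⊆⁅x⁆⇒p-x≡∅ ∅ (⊥-elim ∘ ∉⊥)))

∣p∪q∣≤∣p∣+∣q∣ : (p q : Subset n) → ∣ p ∪ q ∣ ≤ ∣ p ∣ + ∣ q ∣
∣p∪q∣≤∣p∣+∣q∣ []            []            = z≤n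
∣p∪q∣≤∣p∣+∣q∣ (outside ∷ p) (outside ∷ q) = ∣p∪q∣≤∣p∣+∣q∣ p q
∣p∪q∣≤∣p∣+∣q∣ (inside  ∷ p) (outside ∷ q) = s≤s (∣p∪q∣≤∣p∣+∣q∣ p q)
∣p∪q∣≤∣p∣+∣q∣ (outside ∷ p) (inside  ∷ q) =
  ≤-trans (s≤s (∣p∪q∣≤∣p∣+∣q∣ p q)) (≤-reflexive (≡.sym (+-suc ∣ p ∣ ∣ q ∣)))
∣p∪q∣≤∣p∣+∣q∣ (inside  ∷ p) (inside  ∷ q) =
  s≤s (≤-trans (∣p∪q∣≤∣p∣+∣q∣ p q) (+-monoʳ-≤ ∣ p ∣ (n≤1+n ∣ q ∣)))

3≤∣p∣⇒∃-avoiding : (p : Subset n) → 3 ≤ ∣ p ∣ → ∀ x y → ∃[ z ] z ∈ p × z ≢ x × z ≢ y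
3≤∣p∣⇒∃-avoiding p 3≤∣p∣ x y with any? (λ z → z ∈? p ×-dec ¬? (z ≟ x) ×-dec ¬? (z ≟ y))
... | yes found = found
... | no none   =
  contradiction (≤-trans 3≤∣p∣ (≤-trans (p⊆q⇒∣p∣≤∣q∣ p⊆⁅x⁆∪⁅y⁆) ∣⁅x⁆∪⁅y⁆∣≤2)) (<-irrefl refl)
  where
  p⊆⁅x⁆∪⁅y⁆ : p ⊆ ⁅ x ⁆ ∪ ⁅ y ⁆
  p⊆⁅x⁆∪⁅y⁆ {z} z∈p with z ≟ x | z ≟ y
  ... | yes refl | _        = x∈p∪q⁺ (inj₁ (x∈⁅x⁆ z))
  ... | no _     | yes refl = x∈p∪q⁺ (inj₂ (x∈⁅x⁆ z))
  ... | no z≢x   | no z≢y   = contradiction (z , z∈p , z≢x , z≢y) none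
  ∣⁅x⁆∪⁅y⁆∣≤2 : ∣ ⁅ x ⁆ ∪ ⁅ y ⁆ ∣ ≤ 2
  ∣⁅x⁆∪⁅y⁆∣≤2 = ≤-trans (∣p∪q∣≤∣p∣+∣q∣ ⁅ x ⁆ ⁅ y ⁆) (≤-reflexive (cong₂ _+_ (∣⁅x⁆∣≡1 x) (∣⁅x⁆∣≡1 y)))

IsPartition : Parts n k → Set
IsPartition P = ∀ v → Σ (Fin _) λ i → v ∈ lookup P i × (∀ j → v ∈ lookup P j → j ≡ i)

IsPartition-unique : {P : Parts n k} → IsPartition P → w ∈ lookup P i → w ∈ lookup P j → i ≡ j
IsPartition-unique {w = w} π w∈Pi w∈Pj with _ , _ , unique ← π w =
  ≡.trans (unique _ w∈Pi) (≡.sym (unique _ w∈Pj))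

Parts-antisym : {P Q : Parts n k} →
                (∀ j → lookup P j ⊆ lookup Q j) → (∀ j → lookup Q j ⊆ lookup P j) → P ≡ Q
Parts-antisym P⊆Q Q⊆P = Pointwise-≡⇒≡ (ext λ j → ⊆-antisym (P⊆Q j) (Q⊆P j))

-- A record rather than a Σ-type, so that P can be inferred from Together P w w′.
record Together (P : Parts n k) (w w′ : Fin n) : Set where
  constructor together
  field
    part   : Fin k
    ∈part  : w ∈ lookup P part
    ∈part′ : w′ ∈ lookup P part

Together-sym : {P : Parts n k} → Together P w w′ → Together P w′ w
Together-sym (together i w∈ w′∈) = together i w′∈ w∈

Together-resp-≈ₚ : {P Q : Parts n k} → P ≈ₚ Q → Together P w w′ → Together Q w w′
Together-resp-≈ₚ {w = w} {w′ = w′} {P = P} {Q} P≈Q (together i w∈ w′∈) =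
  together (index inQ) (proj₁ (lookup-index inQ)) (proj₂ (lookup-index inQ))
  where
  inQ : Any (λ S → w ∈ S × w′ ∈ S) Q
  inQ = toList⁻ (Any-resp-↭ P≈Q (toList⁺ (lose (∈-lookup i P) (w∈ , w′∈))))

Together⇒¬Adj : {P : Parts n k} → IsStablePartition G P → Together P w w′ → ¬ Adj G w w′
Together⇒¬Adj (independent , _) (together i w∈ w′∈) = independent i _ _ w∈ w′∈

pigeonhole-Together : {P : Parts n k} → IsPartition P → (f : Fin (suc k) → Fin n) →
                      ∃₂ λ i j → i < j × Together P (f i) (f j)
pigeonhole-Together {P = P} π f with i , j , i<j , same ← pigeonhole (n<1+n _) (proj₁ ∘ π ∘ f) =
  i , j , i<j , together (proj₁ (π (f i))) (proj₁ (proj₂ (π (f i))))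
                         (subst (λ l → f j ∈ lookup P l) (≡.sym same) (proj₁ (proj₂ (π (f j)))))

-- Counting the parts that contain w makes "w lies in exactly one part" invariant under ≈ₚ.
multiplicity : Fin n → List (Subset n) → ℕ
multiplicity w Ps = length (filter (w ∈?_) Ps)

multiplicity-↭ : {Ps Qs : List (Subset n)} → Ps ↭ Qs → multiplicity w Ps ≡ multiplicity w Qs
multiplicity-↭ {w = w} Ps↭Qs = ↭-length (filter-↭ (w ∈?_) Ps↭Qs)

absent⇒multiplicity≡0 : (P : Parts n k) → (∀ j → w ∉ lookup P j) → multiplicity w (toList P) ≡ 0
absent⇒multiplicity≡0 [] _ = refl
absent⇒multiplicity≡0 {w = w} (S ∷ P) w∉P with w ∈? S
... | yes w∈S = contradiction w∈S (w∉P zero)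
... | no _    = absent⇒multiplicity≡0 P (w∉P ∘ suc)

multiplicity≡0⇒absent : (P : Parts n k) → multiplicity w (toList P) ≡ 0 → ∀ j → w ∉ lookup P j
multiplicity≡0⇒absent {w = w} (S ∷ P) m≡0 j w∈ with w ∈? S | j
... | yes _  | _     with () ← m≡0
... | no w∉S | zero  = w∉S w∈
... | no _   | suc j = multiplicity≡0⇒absent P m≡0 j w∈

unique⇒multiplicity≡1 : (P : Parts n k) → w ∈ lookup P i → (∀ j → w ∈ lookup P j → j ≡ i) →
                        multiplicity w (toList P) ≡ 1
unique⇒multiplicity≡1 {w = w} {i = zero} (S ∷ P) w∈S unique with w ∈? S
... | yes _  = cong suc (absent⇒multiplicity≡0 P λ j w∈Pj → 0≢1+n (≡.sym (unique (suc j) w∈Pj)))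
... | no w∉S = contradiction w∈S w∉S
unique⇒multiplicity≡1 {w = w} {i = suc i} (S ∷ P) w∈Pi unique with w ∈? S
... | yes w∈S = contradiction (unique zero w∈S) 0≢1+n
... | no _    = unique⇒multiplicity≡1 P w∈Pi (λ j w∈Pj → suc-injective (unique (suc j) w∈Pj))

multiplicity≡1⇒unique : (P : Parts n k) → multiplicity w (toList P) ≡ 1 →
                        Σ (Fin k) λ i → w ∈ lookup P i × (∀ j → w ∈ lookup P j → j ≡ i)
multiplicity≡1⇒unique {w = w} (S ∷ P) m≡1 with w ∈? S
... | yes w∈S = zero , w∈S , unique
  where
  unique : ∀ j → w ∈ lookup (S ∷ P) j → j ≡ zero
  unique zero    _    = refl
  unique (suc j) w∈Pj = contradiction w∈Pj (multiplicity≡0⇒absent P (ℕ.suc-injective m≡1) j)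
... | no w∉S with i , w∈Pi , uniqueP ← multiplicity≡1⇒unique P m≡1 = suc i , w∈Pi , unique
  where
  unique : ∀ j → w ∈ lookup (S ∷ P) j → j ≡ suc i
  unique zero    w∈S  = contradiction w∈S w∉S
  unique (suc j) w∈Pj = cong suc (uniqueP j w∈Pj)

IsPartition-resp-≈ₚ : {P Q : Parts n k} → P ≈ₚ Q → IsPartition P → IsPartition Q
IsPartition-resp-≈ₚ {P = P} {Q} P≈Q π w with _ , w∈ , unique ← π w =
  multiplicity≡1⇒unique Q (≡.trans (≡.sym (multiplicity-↭ P≈Q)) (unique⇒multiplicity≡1 P w∈ unique))

∈-delV⁺ : (P : Parts n k) → w ≢ a → w ∈ lookup P j → w ∈ lookup (delV P a) j
∈-delV⁺ {a = a} {j = j} P w≢a w∈Pj =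
  subst (_ ∈_) (≡.sym (lookup-map j (_- a) P)) (x∈p∧x≢y⇒x∈p-y w∈Pj w≢a)

∈-delV⁻ : (P : Parts n k) → w ∈ lookup (delV P a) j → w ≢ a × w ∈ lookup P j
∈-delV⁻ {a = a} {j = j} P w∈ = x∈p-y⁻ (lookup P j) (subst (_ ∈_) (lookup-map j (_- a) P) w∈)

delV-≡⇒⊆ : (P Q : Parts n k) → delV P a ≡ delV Q a → w ≢ a → w ∈ lookup P j → w ∈ lookup Q j
delV-≡⇒⊆ {j = j} P Q P-a≡Q-a w≢a w∈Pj =
  proj₂ (∈-delV⁻ Q (subst (λ R → _ ∈ lookup R j) P-a≡Q-a (∈-delV⁺ P w≢a w∈Pj)))

-- Opaque, so that lookup (move P a i) j does not unfold when P is a literal vector such as Z.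
opaque
  move : Parts n k → Fin n → Fin k → Parts n k
  move P a i = updateAt (delV P a) i (_∪ ⁅ a ⁆)

opaque
  unfolding move

  lookup-move-≡ : (P : Parts n k) → lookup (move P a i) i ≡ (lookup P i - a) ∪ ⁅ a ⁆
  lookup-move-≡ {a = a} {i = i} P =
    ≡.trans (lookup∘updateAt i (delV P a)) (cong (_∪ ⁅ a ⁆) (lookup-map i (_- a) P))

  lookup-move-≢ : (P : Parts n k) → j ≢ i → lookup (move P a i) j ≡ lookup P j - a
  lookup-move-≢ {j = j} {i = i} {a = a} P j≢i =
    ≡.trans (lookup∘updateAt′ j i j≢i (delV P a)) (lookup-map j (_- a) P)

∈-move⁺ : (P : Parts n k) → w ≢ a → w ∈ lookup P j → w ∈ lookup (move P a i) j
∈-move⁺ {j = j} {i = i} P w≢a w∈Pj with j ≟ i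
... | yes refl = subst (_ ∈_) (≡.sym (lookup-move-≡ P)) (x∈p∪q⁺ (inj₁ (x∈p∧x≢y⇒x∈p-y w∈Pj w≢a)))
... | no j≢i   = subst (_ ∈_) (≡.sym (lookup-move-≢ P j≢i)) (x∈p∧x≢y⇒x∈p-y w∈Pj w≢a)

∈-move-moved : (P : Parts n k) → a ∈ lookup (move P a i) i
∈-move-moved {a = a} P = subst (_ ∈_) (≡.sym (lookup-move-≡ P)) (x∈p∪q⁺ (inj₂ (x∈⁅x⁆ a)))

∈-move⁻ : (P : Parts n k) → w ∈ lookup (move P a i) j → (w ≡ a × j ≡ i) ⊎ (w ≢ a × w ∈ lookup P j)
∈-move⁻ {a = a} {i = i} {j = j} P w∈ with j ≟ i
... | yes refl with x∈p∪q⁻ (lookup P j - a) ⁅ a ⁆ (subst (_ ∈_) (lookup-move-≡ P) w∈)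
...   | inj₁ w∈Pj-a = inj₂ (x∈p-y⁻ (lookup P j) w∈Pj-a)
...   | inj₂ w∈⁅a⁆  = inj₁ (x∈⁅y⁆⇒x≡y a w∈⁅a⁆ , refl)
∈-move⁻ {j = j} P w∈ | no j≢i = inj₂ (x∈p-y⁻ (lookup P j) (subst (_ ∈_) (lookup-move-≢ P j≢i) w∈))

∈-move⁻-moved : (P : Parts n k) → a ∈ lookup (move P a i) j → j ≡ i
∈-move⁻-moved P a∈ with ∈-move⁻ P a∈
... | inj₁ (_ , j≡i)  = j≡i
... | inj₂ (a≢a , _) = contradiction refl a≢a

∈-move⁻-≢ : (P : Parts n k) → w ≢ a → w ∈ lookup (move P a i) j → w ∈ lookup P j
∈-move⁻-≢ P w≢a w∈ with ∈-move⁻ P w∈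
... | inj₁ (w≡a , _)  = contradiction w≡a w≢a
... | inj₂ (_ , w∈Pj) = w∈Pj

delV-move : (P : Parts n k) → delV (move P a i) a ≡ delV P a
delV-move {a = a} {i = i} P = Parts-antisym
  (λ j w∈ → let w≢a , w∈moved = ∈-delV⁻ (move P a i) w∈ in ∈-delV⁺ P w≢a (∈-move⁻-≢ P w≢a w∈moved))
  (λ j w∈ → let w≢a , w∈Pj = ∈-delV⁻ P w∈ in ∈-delV⁺ (move P a i) w≢a (∈-move⁺ P w≢a w∈Pj))

move-unique : (P Q : Parts n k) → delV Q a ≡ delV P a → a ∈ lookup Q i →
              (∀ j → a ∈ lookup Q j → j ≡ i) → Q ≡ move P a i
move-unique {a = a} {i = i} P Q Q-a≡P-a a∈Qi unique = Parts-antisym Q⊆move move⊆Q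
  where
  Q⊆move : ∀ j → lookup Q j ⊆ lookup (move P a i) j
  Q⊆move j {w} w∈Qj with w ≟ a
  ... | yes refl = subst (λ l → a ∈ lookup (move P a i) l) (≡.sym (unique j w∈Qj)) (∈-move-moved P)
  ... | no w≢a   = ∈-move⁺ P w≢a (delV-≡⇒⊆ Q P Q-a≡P-a w≢a w∈Qj)
  move⊆Q : ∀ j → lookup (move P a i) j ⊆ lookup Q j
  move⊆Q j w∈ with ∈-move⁻ P w∈
  ... | inj₁ (refl , refl) = a∈Qi
  ... | inj₂ (w≢a , w∈Pj)  = delV-≡⇒⊆ P Q (≡.sym Q-a≡P-a) w≢a w∈Pj

move-self : (P : Parts n k) → IsPartition P → a ∈ lookup P i → move P a i ≡ P
move-self P π a∈Pi =
  ≡.sym (move-unique P P refl a∈Pi λ j a∈Pj → IsPartition-unique {P = P} π a∈Pj a∈Pi)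

move-comm-⊆ : (P : Parts n k) → a ≢ b →
              lookup (move (move P a i) b j) l ⊆ lookup (move (move P b j) a i) l
move-comm-⊆ {a = a} {b = b} {i = i} {j = j} P a≢b w∈ with ∈-move⁻ (move P a i) w∈
... | inj₁ (refl , refl)   = ∈-move⁺ (move P b j) (≢-sym a≢b) (∈-move-moved P)
... | inj₂ (w≢b , w∈moved) with ∈-move⁻ P w∈moved
...   | inj₁ (refl , refl) = ∈-move-moved (move P b j)
...   | inj₂ (w≢a , w∈P)   = ∈-move⁺ (move P b j) w≢a (∈-move⁺ P w≢b w∈P)

move-comm : (P : Parts n k) → a ≢ b → move (move P a i) b j ≡ move (move P b j) a i
move-comm P a≢b = Parts-antisym (λ _ → move-comm-⊆ P a≢b) (λ _ → move-comm-⊆ P (≢-sym a≢b))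

move-stable : (P : Parts n k) → IsStablePartition G P → (∀ w → w ∈ lookup P i → ¬ Adj G a w) →
              IsStablePartition G (move P a i)
move-stable {G = G} {i = i} {a = a} P (independent , π) a-isolated = independent′ , π′
  where
  independent′ : ∀ j → Independent G (lookup (move P a i) j)
  independent′ j w w′ w∈ w′∈ with ∈-move⁻ P w∈ | ∈-move⁻ P w′∈
  ... | inj₁ (refl , _)    | inj₁ (refl , _)    = Graph.irrefl G
  ... | inj₁ (refl , refl) | inj₂ (_ , w′∈Pi)   = a-isolated w′ w′∈Pi
  ... | inj₂ (_ , w∈Pi)    | inj₁ (refl , refl) = a-isolated w w∈Pi ∘ Graph.sym G
  ... | inj₂ (_ , w∈Pj)    | inj₂ (_ , w′∈Pj)   = independent j w w′ w∈Pj w′∈Pj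
  π′ : IsPartition (move P a i)
  π′ w with w ≟ a
  ... | yes refl = i , ∈-move-moved P , λ j → ∈-move⁻-moved P
  ... | no w≢a with j , w∈Pj , unique ← π w =
    j , ∈-move⁺ P w≢a w∈Pj , λ l w∈ → unique l (∈-move⁻-≢ P w≢a w∈)

Together-move⁺ : (P : Parts n k) → w ≢ a → w′ ≢ a → Together P w w′ → Together (move P a i) w w′
Together-move⁺ P w≢a w′≢a (together j w∈ w′∈) =
  together j (∈-move⁺ P w≢a w∈) (∈-move⁺ P w′≢a w′∈)

Together-move⁻ : (P : Parts n k) → w ≢ a → w′ ≢ a → Together (move P a i) w w′ → Together P w w′
Together-move⁻ P w≢a w′≢a (together j w∈ w′∈) =
  together j (∈-move⁻-≢ P w≢a w∈) (∈-move⁻-≢ P w′≢a w′∈)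

Together-moved : (P : Parts n k) → w ≢ a → Together (move P a i) a w → w ∈ lookup P i
Together-moved P w≢a (together j a∈ w∈) =
  subst (λ l → _ ∈ lookup P l) (∈-move⁻-moved P a∈) (∈-move⁻-≢ P w≢a w∈)

move-next-to-neighbour : (P W : Parts n k) → IsStablePartition G W → W ≈ₚ move P a i →
                         w ≢ a → w ∈ lookup P i → ¬ Adj G a w
move-next-to-neighbour {G = G} P W W-stable W≈ w≢a w∈Pi = Together⇒¬Adj {G = G} W-stable
  (Together-resp-≈ₚ {Q = W} (↭-sym W≈) (together _ (∈-move-moved P) (∈-move⁺ P w≢a w∈Pi)))

toList-map-inv : {A B : Set} (f : A → B) (xs : Vec A k) {ys : List A} →
                 toList (map f xs) ≡ List.map f ys → ∃[ zs ] toList zs ≡ ys × map f zs ≡ map f xs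
toList-map-inv f []       {[]}     _  = [] , refl , refl
toList-map-inv f (x ∷ xs) {y ∷ ys} eq
  with zs , zs≡ys , fzs≡fxs ← toList-map-inv f xs (∷-injectiveʳ eq) =
  y ∷ zs , cong (y ∷_) zs≡ys , cong₂ _∷_ (≡.sym (∷-injectiveˡ eq)) fzs≡fxs

-- Pulling the permutation back along (_- a) gives Q ≈ₚ W with Q - a ≡ P - a, and since a lies
-- in exactly one part of Q, Q is P with a moved into that part.
neighbour⇒move : {W : Parts n k} (P : Parts n k) → IsPartition W → delV W a ≈ₚ delV P a →
                 ∃[ i ] W ≈ₚ move P a i
neighbour⇒move {a = a} {W = W} P πW W-a≈P-a
  with Qs , P-a≡Qs-a , W↭Qs ← ↭-map-inv (_- a) (subst (_↭ _) (toList-map (_- a) W) W-a≈P-a)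
  with Q , refl , Q-a≡P-a ← toList-map-inv (_- a) P P-a≡Qs-a
  with i , a∈Qi , unique ← IsPartition-resp-≈ₚ W↭Qs πW a
  = i , ↭-trans W↭Qs (↭-reflexive (cong toList (move-unique P Q Q-a≡P-a a∈Qi unique)))

neighbour-of-move⇒move : {W : Parts n k} (P : Parts n k) → IsPartition W →
                         delV W a ≈ₚ delV (move P a i) a → ∃[ j ] W ≈ₚ move P a j
neighbour-of-move⇒move P πW W-a≈ =
  neighbour⇒move P πW (↭-trans W-a≈ (↭-reflexive (cong toList (delV-move P))))

nonempty-parts⇒≉ₚ : (P Q : Parts n k) → (∀ i → Nonempty (lookup P i)) → lookup Q j ≡ ∅ → ¬ P ≈ₚ Q
nonempty-parts⇒≉ₚ {j = j} P Q nonempty Qj≡∅ P≈Q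
  with Qj∈P ← ∈-toList⁻ (Any-resp-↭ (↭-sym P≈Q) (∈-toList⁺ (∈-lookup j Q)))
  with w , w∈ ← nonempty (index Qj∈P)
  = ∉⊥ (subst (w ∈_) (≡.trans (≡.sym (lookup-index Qj∈P)) Qj≡∅) w∈)

module Bipartition {n} (G : Graph n) (X : Subset n)
                   (X-indep : Independent G X) (∁X-indep : Independent G (∁ X))
                   (3≤∣X∣ : 3 ≤ ∣ X ∣) (3≤∣∁X∣ : 3 ≤ ∣ ∁ X ∣) where

  Z : Parts n 3
  Z = Zpart X (∁ X)

  Z-stable : IsStablePartition G Z
  Z-stable = independent , partition
    where
    independent : ∀ i → Independent G (lookup Z i)
    independent zero                     = X-indep
    independent (suc zero)               = ∁X-indep
    independent (suc (suc zero)) w _ w∈∅ = ⊥-elim (∉⊥ w∈∅)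
    partition : IsPartition Z
    partition w with w ∈? X
    ... | yes w∈X = zero , w∈X , unique
      where
      unique : ∀ j → w ∈ lookup Z j → j ≡ zero
      unique zero             _    = refl
      unique (suc zero)       w∈∁X = contradiction w∈X (x∈∁p⇒x∉p w∈∁X)
      unique (suc (suc zero)) w∈∅  = contradiction w∈∅ ∉⊥
    ... | no w∉X = suc zero , x∉p⇒x∈∁p w∉X , unique
      where
      unique : ∀ j → w ∈ lookup Z j → j ≡ suc zero
      unique zero             w∈X = contradiction w∈X w∉X
      unique (suc zero)       _   = refl
      unique (suc (suc zero)) w∈∅ = contradiction w∈∅ ∉⊥

  Zx≡move : ∀ u → Zx X (∁ X) u ≡ move Z u (# 2)
  Zx≡move u with lookup X u in X[u]
  ... | inside = move-unique Z _ Zu-u≡Z-u (x∈⁅x⁆ u) unique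
    where
    u∈X : u ∈ X
    u∈X = lookup⇒[]= u X X[u]
    Zu-u≡Z-u : delV ((X - u) ∷ ∁ X ∷ ⁅ u ⁆ ∷ []) u ≡ delV Z u
    Zu-u≡Z-u = cong₂ _∷_ (p─q─q≡p─q X ⁅ u ⁆) (cong₂ _∷_ refl (cong₂ _∷_ (⁅x⁆-x≡∅-x u) refl))
    unique : ∀ j → u ∈ lookup ((X - u) ∷ ∁ X ∷ ⁅ u ⁆ ∷ []) j → j ≡ # 2
    unique zero             u∈X-u = contradiction refl (proj₁ (x∈p-y⁻ X u∈X-u))
    unique (suc zero)       u∈∁X  = contradiction u∈X (x∈∁p⇒x∉p u∈∁X)
    unique (suc (suc zero)) _     = refl
  ... | outside = move-unique Z _ Zu-u≡Z-u (x∈⁅x⁆ u) unique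
    where
    u∉X : u ∉ X
    u∉X u∈X with () ← ≡.trans (≡.sym ([]=⇒lookup u∈X)) X[u]
    Zu-u≡Z-u : delV (X ∷ (∁ X - u) ∷ ⁅ u ⁆ ∷ []) u ≡ delV Z u
    Zu-u≡Z-u = cong₂ _∷_ refl (cong₂ _∷_ (p─q─q≡p─q (∁ X) ⁅ u ⁆) (cong₂ _∷_ (⁅x⁆-x≡∅-x u) refl))
    unique : ∀ j → u ∈ lookup (X ∷ (∁ X - u) ∷ ⁅ u ⁆ ∷ []) j → j ≡ # 2
    unique zero             u∈X    = contradiction u∈X u∉X
    unique (suc zero)       u∈∁X-u = contradiction refl (proj₁ (x∈p-y⁻ (∁ X) u∈∁X-u))
    unique (suc (suc zero)) _      = refl

  isolated : w ≢ a → ¬ Together (move Z a (# 2)) a w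
  isolated w≢a = ∉⊥ ∘ Together-moved Z w≢a

  Z-separates : w ∈ X → w′ ∉ X → ¬ Together Z w w′
  Z-separates w∈X w′∉X (together zero             _    w′∈X) = w′∉X w′∈X
  Z-separates w∈X w′∉X (together (suc zero)       w∈∁X _)    = x∈∁p⇒x∉p w∈∁X w∈X
  Z-separates w∈X w′∉X (together (suc (suc zero)) w∈∅  _)    = ∉⊥ w∈∅

  module _ {u v : Fin n} (u∈X : u ∈ X) (v∉X : v ∉ X) (u~v : Adj G u v)
           {W : Parts n 3} (W-stable : IsStablePartition G W) where

    private
      Zu Zv : Parts n 3
      Zu = move Z u (# 2)
      Zv = move Z v (# 2)

      u≢v : u ≢ v
      u≢v = ∈∧∉⇒≢ u∈X v∉X

      v∈∁X : v ∈ ∁ X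
      v∈∁X = x∉p⇒x∈∁p v∉X

    moved-u : W ≈ₚ move Z u i → W ≈ₚ Z ⊎ W ≈ₚ Zu
    moved-u {i = zero} W≈ =
      inj₁ (subst (W ≈ₚ_) (move-self Z (proj₂ Z-stable) u∈X) W≈)
    moved-u {i = suc zero} W≈ =
      contradiction u~v (move-next-to-neighbour {G = G} Z W W-stable W≈ (≢-sym u≢v) v∈∁X)
    moved-u {i = suc (suc zero)} W≈ = inj₂ W≈

    moved-v : W ≈ₚ move Z v i → W ≈ₚ Z ⊎ W ≈ₚ Zv
    moved-v {i = zero} W≈ =
      contradiction (Graph.sym G u~v) (move-next-to-neighbour {G = G} Z W W-stable W≈ u≢v u∈X)
    moved-v {i = suc zero} W≈ =
      inj₁ (subst (W ≈ₚ_) (move-self Z (proj₂ Z-stable) v∈∁X) W≈)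
    moved-v {i = suc (suc zero)} W≈ = inj₂ W≈

    module _ {a b : Fin n} {i j : Fin 3} (a≢u : a ≢ u) (b≢v : b ≢ v)
             (W≈Zu+a : W ≈ₚ move Zu a i) (W≈Zv+b : W ≈ₚ move Zv b j) where

      private
        viaZu : w ≢ a → w′ ≢ a → Together W w w′ → Together Zu w w′
        viaZu w≢a w′≢a = Together-move⁻ Zu w≢a w′≢a ∘ Together-resp-≈ₚ {P = W} W≈Zu+a

        viaZv : w ≢ b → w′ ≢ b → Together W w w′ → Together Zv w w′
        viaZv w≢b w′≢b = Together-move⁻ Zv w≢b w′≢b ∘ Together-resp-≈ₚ {P = W} W≈Zv+b

        fromZu : w ≢ a → w′ ≢ a → Together Zu w w′ → Together W w w′
        fromZu w≢a w′≢a = Together-resp-≈ₚ {Q = W} (↭-sym W≈Zu+a) ∘ Together-move⁺ Zu w≢a w′≢a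

        fromZv : w ≢ b → w′ ≢ b → Together Zv w w′ → Together W w w′
        fromZv w≢b w′≢b = Together-resp-≈ₚ {Q = W} (↭-sym W≈Zv+b) ∘ Together-move⁺ Zv w≢b w′≢b

      u-alone : x ∈ X → x ≢ u → x ≢ a → x ≢ b → u ≢ b → ⊥
      u-alone x∈X x≢u x≢a x≢b u≢b = isolated x≢u (viaZu (≢-sym a≢u) x≢a (fromZv u≢b x≢b
        (Together-move⁺ Z u≢v (∈∧∉⇒≢ x∈X v∉X) (together zero u∈X x∈X))))

      v-alone : y ∈ ∁ X → y ≢ v → y ≢ a → y ≢ b → v ≢ a → ⊥
      v-alone y∈∁X y≢v y≢a y≢b v≢a = isolated y≢v (viaZv (≢-sym b≢v) y≢b (fromZu v≢a y≢a
        (Together-move⁺ Z (≢-sym u≢v) (≢-sym (∈∧∉⇒≢ u∈X (x∈∁p⇒x∉p y∈∁X)))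
          (together (suc zero) v∈∁X y∈∁X))))

      -- u, v, x ∈ X - u and y ∈ ∁ X - v would need four different parts of W.
      swapped : a ≡ v → b ≡ u → ⊥
      swapped refl refl
        with x , x∈X , x≢u , _ ← 3≤∣p∣⇒∃-avoiding X 3≤∣X∣ u u
        with y , y∈∁X , y≢v , _ ← 3≤∣p∣⇒∃-avoiding (∁ X) 3≤∣∁X∣ v v
        with y∉X ← x∈∁p⇒x∉p y∈∁X
        with x≢v ← ∈∧∉⇒≢ x∈X v∉X
        with y≢u ← ≢-sym (∈∧∉⇒≢ u∈X y∉X)
        with pigeonhole-Together {P = W} (proj₂ W-stable) (lookup (u ∷ v ∷ x ∷ y ∷ []))
      ... | zero           , suc zero             , _ , uv = Together⇒¬Adj {G = G} W-stable uv u~v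
      ... | zero           , suc (suc zero)       , _ , ux = isolated x≢u (viaZu u≢v x≢v ux)
      ... | zero           , suc (suc (suc zero)) , _ , uy = isolated y≢u (viaZu u≢v y≢v uy)
      ... | suc zero       , suc (suc zero)       , _ , vx = isolated x≢v (viaZv (≢-sym u≢v) x≢u vx)
      ... | suc zero       , suc (suc (suc zero)) , _ , vy = isolated y≢v (viaZv (≢-sym u≢v) y≢u vy)
      ... | suc (suc zero) , suc (suc (suc zero)) , _ , xy =
        Z-separates x∈X y∉X (Together-move⁻ Z x≢u y≢u (viaZu x≢v y≢v xy))
      ... | suc zero          , suc zero             , s≤s ()                , _
      ... | suc (suc _)       , suc zero             , s≤s ()                , _
      ... | suc (suc _)       , suc (suc zero)       , s≤s (s≤s ())          , _
      ... | suc (suc (suc _)) , suc (suc (suc zero)) , s≤s (s≤s (s≤s ()))    , _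

      -- A partner x ∈ X of u must avoid u, a and b, but 3 ≤ ∣ X ∣ only lets it avoid two of
      -- them; so use x when a or b lies outside X, and a partner y ∈ ∁ X of v otherwise.
      others-moved : ⊥
      others-moved with a ≟ v | b ≟ u
      ... | yes a≡v | yes b≡u = swapped a≡v b≡u
      ... | yes refl | no b≢u with x , x∈X , x≢u , x≢b ← 3≤∣p∣⇒∃-avoiding X 3≤∣X∣ u b =
        u-alone x∈X x≢u (∈∧∉⇒≢ x∈X v∉X) x≢b (≢-sym b≢u)
      ... | no a≢v | yes refl with y , y∈∁X , y≢v , y≢a ← 3≤∣p∣⇒∃-avoiding (∁ X) 3≤∣∁X∣ v a =
        v-alone y∈∁X y≢v y≢a (≢-sym (∈∧∉⇒≢ u∈X (x∈∁p⇒x∉p y∈∁X))) (≢-sym a≢v)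
      ... | no a≢v | no b≢u with a ∈? X | b ∈? X
      ...   | no a∉X | _ with x , x∈X , x≢u , x≢b ← 3≤∣p∣⇒∃-avoiding X 3≤∣X∣ u b =
        u-alone x∈X x≢u (∈∧∉⇒≢ x∈X a∉X) x≢b (≢-sym b≢u)
      ...   | yes _ | no b∉X with x , x∈X , x≢u , x≢a ← 3≤∣p∣⇒∃-avoiding X 3≤∣X∣ u a =
        u-alone x∈X x≢u x≢a (∈∧∉⇒≢ x∈X b∉X) (≢-sym b≢u)
      ...   | yes _ | yes b∈X with y , y∈∁X , y≢v , y≢a ← 3≤∣p∣⇒∃-avoiding (∁ X) 3≤∣∁X∣ v a =
        v-alone y∈∁X y≢v y≢a (≢-sym (∈∧∉⇒≢ b∈X (x∈∁p⇒x∉p y∈∁X))) (≢-sym a≢v)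

    no-common-neighbour : ¬ W ≈ₚ Z → AdjB W Zu → AdjB W Zv → ⊥
    no-common-neighbour W≉Z (W≉Zu , a , W-a≈Zu-a) (W≉Zv , b , W-b≈Zv-b) with a ≟ u | b ≟ v
    ... | yes refl | _ with _ , W≈ ← neighbour-of-move⇒move Z (proj₂ W-stable) W-a≈Zu-a =
      [ W≉Z , W≉Zu ] (moved-u W≈)
    ... | no _ | yes refl with _ , W≈ ← neighbour-of-move⇒move Z (proj₂ W-stable) W-b≈Zv-b =
      [ W≉Z , W≉Zv ] (moved-v W≈)
    ... | no a≢u | no b≢v =
      others-moved a≢u b≢v (proj₂ (neighbour⇒move Zu (proj₂ W-stable) W-a≈Zu-a))
                           (proj₂ (neighbour⇒move Zv (proj₂ W-stable) W-b≈Zv-b))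

  common-neighbour : ∀ {u v} → u ≢ v → ¬ Adj G u v →
                     Σ[ W ∈ Parts n 3 ] IsStablePartition G W × AdjB W (move Z u (# 2)) ×
                                        AdjB W (move Z v (# 2)) × ¬ W ≈ₚ Z
  common-neighbour {u} {v} u≢v u≁v =
    W , W-stable , (W≉Zu , v , W-v≈Zu-v) , (W≉Zv , u , W-u≈Zv-u) , W≉Z
    where
    Zu Zv W : Parts n 3
    Zu = move Z u (# 2)
    Zv = move Z v (# 2)
    W  = move Zu v (# 2)

    W-stable : IsStablePartition G W
    W-stable = move-stable {G = G} Zu Zu-stable v-isolated
      where
      Zu-stable : IsStablePartition G Zu
      Zu-stable = move-stable {G = G} Z Z-stable λ _ w∈∅ → ⊥-elim (∉⊥ w∈∅)
      v-isolated : ∀ w → w ∈ lookup Zu (# 2) → ¬ Adj G v w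
      v-isolated w w∈ with ∈-move⁻ Z w∈
      ... | inj₁ (refl , _) = u≁v ∘ Graph.sym G
      ... | inj₂ (_ , w∈∅)  = ⊥-elim (∉⊥ w∈∅)

    uv-together : Together W u v
    uv-together = together (# 2) (∈-move⁺ Zu u≢v (∈-move-moved Z)) (∈-move-moved Zu)

    W≉Zu : ¬ W ≈ₚ Zu
    W≉Zu W≈Zu = isolated (≢-sym u≢v) (Together-resp-≈ₚ W≈Zu uv-together)

    W≉Zv : ¬ W ≈ₚ Zv
    W≉Zv W≈Zv = isolated u≢v (Together-resp-≈ₚ W≈Zv (Together-sym uv-together))

    W-v≈Zu-v : delV W v ≈ₚ delV Zu v
    W-v≈Zu-v = ↭-reflexive (cong toList (delV-move Zu))

    W-u≈Zv-u : delV W u ≈ₚ delV Zv u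
    W-u≈Zv-u = ↭-reflexive (cong toList (begin
      delV W u                      ≡⟨ cong (λ R → delV R u) (move-comm Z u≢v) ⟩
      delV (move Zv u (# 2)) u      ≡⟨ delV-move Zv ⟩
      delV Zv u                     ∎))
      where open ≡.≡-Reasoning

    W≉Z : ¬ W ≈ₚ Z
    W≉Z = nonempty-parts⇒≉ₚ {j = # 2} W Z nonempty refl
      where
      nonempty : ∀ i → Nonempty (lookup W i)
      nonempty zero with x , x∈X , x≢u , x≢v ← 3≤∣p∣⇒∃-avoiding X 3≤∣X∣ u v =
        x , ∈-move⁺ Zu x≢v (∈-move⁺ Z x≢u x∈X)
      nonempty (suc zero) with y , y∈∁X , y≢u , y≢v ← 3≤∣p∣⇒∃-avoiding (∁ X) 3≤∣∁X∣ u v =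
        y , ∈-move⁺ Zu y≢v (∈-move⁺ Z y≢u y∈∁X)
      nonempty (suc (suc zero)) = v , ∈-move-moved Zu

  adjacent⇒no-common-neighbour : ∀ {u v W} → Adj G u v → IsStablePartition G W → ¬ W ≈ₚ Z →
                                 AdjB W (Zx X (∁ X) u) → AdjB W (Zx X (∁ X) v) → ⊥
  adjacent⇒no-common-neighbour {u} {v} u~v W-stable W≉Z rewrite Zx≡move u | Zx≡move v
    with u ∈? X | v ∈? X
  ... | yes u∈X | yes v∈X = λ _ _ → X-indep u v u∈X v∈X u~v
  ... | no u∉X  | no v∉X  = λ _ _ → ∁X-indep u v (x∉p⇒x∈∁p u∉X) (x∉p⇒x∈∁p v∉X) u~v
  ... | yes u∈X | no v∉X  = no-common-neighbour u∈X v∉X u~v W-stable W≉Z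
  ... | no u∉X  | yes v∈X = flip (no-common-neighbour v∈X u∉X (Graph.sym G u~v) W-stable W≉Z)

  nonadjacent⇒common-neighbour : ∀ {u v} → u ≢ v → ¬ Adj G u v →
    Σ[ W ∈ Parts n 3 ] IsStablePartition G W × AdjB W (Zx X (∁ X) u) × AdjB W (Zx X (∁ X) v) × ¬ W ≈ₚ Z
  nonadjacent⇒common-neighbour {u} {v} rewrite Zx≡move u | Zx≡move v = common-neighbour

lemma5p7 : (n : ℕ) → 6 ≤ n → (T : Graph n) → IsTree T →
    (X Y : Subset n) → IsBipartition T X Y → 3 ≤ ∣ X ∣ → 3 ≤ ∣ Y ∣ →
    (u v : Fin n) → ¬ (u ≡ v) →
    ((Σ[ W ∈ Parts n 3 ] IsStablePartition T W × AdjB W (Zx X Y u) × AdjB W (Zx X Y v)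
        × ¬ (W ≈ₚ Zpart X Y))
     ⇔ (¬ Adj T u v))
lemma5p7 n _ T _ X _ (refl , X-indep , ∁X-indep) 3≤∣X∣ 3≤∣∁X∣ u v u≢v =
  mk⇔ (λ (_ , W-stable , W~Zu , W~Zv , W≉Z) u~v →
         adjacent⇒no-common-neighbour u~v W-stable W≉Z W~Zu W~Zv)
      (nonadjacent⇒common-neighbour u≢v)
  where open Bipartition T X X-indep ∁X-indep 3≤∣X∣ 3≤∣∁X∣
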